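{- Let $\epsilon\in\{0,1\}$. Any two $\{0,1\}$-labeled trees $\tau'$, $\tau''$ sharing the same underlying (unlabeled, embedded) rooted tree are $\leftrightsquigarrow_\epsilon$-equivalent.
   Context: A $\{0,1\}$-labeled tree is a finite rooted tree with an ordering of the children of each vertex (embedded rooted tree) together with a label in $\{0,1\}$ on each vertex. For two such labelings $\tau',\tau''$ of the same underlying embedded rooted tree $\varsigma$ and $\epsilon\in\{0,1\}$, write $\tau'\leftrightsquigarrow'_\epsilon\tau''$ if there is a path $\kappa$ in $\varsigma$ such that (1) $\kappa$ contains the root of $\varsigma$ (a path may consist of the root alone); (2) the labels of $\tau'$ and $\tau''$ agree on all vertices of $\varsigma$ not in $\kappa$; (3) on all vertices of $\kappa$ except the one of greatest depth, the labels of $\tau'$ and $\tau''$ agree, and they alternate along $\kappa$ starting with $\epsilon$ at the root. The relation $\leftrightsquigarrow_\epsilon$ is the transitive closure of $\leftrightsquigarrow'_\epsilon$. -}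

module Defs where

open import Data.Bool using (Bool; not)
open import Data.List using (List; []; _∷_; map)
open import Relation.Binary.Construct.Closure.Transitive using (TransClosure)

-- Embedded (plane) rooted trees: a vertex with an ordered list of children.
data Tree : Set where
  node : List Tree → Tree

-- {0,1}-labeled embedded rooted trees (label 0 = false, 1 = true).
data LTree : Set where
  lnode : Bool → List LTree → LTree

shape : LTree → Tree
shapes : List LTree → List Tree
shape (lnode _ ts) = node (shapes ts)
shapes [] = []
shapes (t ∷ ts) = shape t ∷ shapes ts

-- The path κ starts at the root and descends to its deepest vertex v.
-- 'stop': the current vertex is the deepest vertex of κ: its label may change
--   arbitrarily, everything below it is unchanged.
-- 'down': the current vertex is on κ but not deepest: its label is ε in both
--   trees, and exactly one child subtree is modified by a step with the
--   alternated label (not ε); the other children are unchanged.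
data Step (ε : Bool) : LTree → LTree → Set
data StepChildren (ε : Bool) : List LTree → List LTree → Set

data Step ε where
  stop : ∀ a b ts → Step ε (lnode a ts) (lnode b ts)
  down : ∀ {ts us} → StepChildren (not ε) ts us → Step ε (lnode ε ts) (lnode ε us)

data StepChildren ε where
  here  : ∀ {t u} ts → Step ε t u → StepChildren ε (t ∷ ts) (u ∷ ts)
  there : ∀ t {ts us} → StepChildren ε ts us → StepChildren ε (t ∷ ts) (t ∷ us)

Equiv : Bool → LTree → LTree → Set
Equiv ε = TransClosure (Step ε)

{-# OPTIONS --safe #-}
module Submission where

open import Defs
open import Data.Bool using (Bool; not)
open import Data.List using (List; []; _∷_)
open import Data.List.Properties using (∷-injective)
open import Data.Product using (_,_)
open import Relation.Binary.PropositionalEquality using (_≡_; refl)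
open import Relation.Binary.Construct.Closure.Transitive using (TransClosure; [_]; _∷_)
-- Star's ε is renamed: here ε is the label the alternation starts with.
open import Relation.Binary.Construct.Closure.ReflexiveTransitive
  using (Star; _◅_; _◅◅_; gmap) renaming (ε to ⋆-refl)

-- First set the root label to ε (the path consisting
-- of the root alone).  Then relabel the children one at a time: a path through
-- a root labeled ε continues into a child with alternation starting at not ε,
-- so the induction hypothesis for not ε relabels that child.  Finally set the
-- root label to its target value.

module _ {A : Set} {R : A → A → Set} where

  ⁺⇒⋆ : ∀ {x y} → TransClosure R x y → Star R x y
  ⁺⇒⋆ [ r ]   = r ◅ ⋆-refl
  ⁺⇒⋆ (r ∷ p) = r ◅ ⁺⇒⋆ p

  _▻⁺_ : ∀ {x y z} → Star R x y → R y z → TransClosure R x z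
  ⋆-refl  ▻⁺ r = [ r ]
  (s ◅ p) ▻⁺ r = s ∷ (p ▻⁺ r)

node-injective : ∀ {ts us} → node ts ≡ node us → ts ≡ us
node-injective refl = refl

StepChildren⋆ : Bool → List LTree → List LTree → Set
StepChildren⋆ ε = Star (StepChildren ε)

here⋆ : ∀ {ε t u} ts → Equiv ε t u → StepChildren⋆ ε (t ∷ ts) (u ∷ ts)
here⋆ ts p = gmap (_∷ ts) (here ts) (⁺⇒⋆ p)

there⋆ : ∀ {ε ts us} t → StepChildren⋆ ε ts us → StepChildren⋆ ε (t ∷ ts) (t ∷ us)
there⋆ t = gmap (t ∷_) (there t)

down⋆ : ∀ {ε ts us} → StepChildren⋆ (not ε) ts us → Star (Step ε) (lnode ε ts) (lnode ε us)
down⋆ {ε} = gmap (lnode ε) down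

relabel : ∀ {ε ts us} a b → StepChildren⋆ (not ε) ts us → Equiv ε (lnode a ts) (lnode b us)
relabel {ε} {ts} {us} a b children = stop a ε ts ∷ (down⋆ children ▻⁺ stop ε b us)

sameShape⇒Equiv : ∀ ε τ′ τ″ → shape τ′ ≡ shape τ″ → Equiv ε τ′ τ″
sameShapes⇒StepChildren⋆ : ∀ ε ts us → shapes ts ≡ shapes us → StepChildren⋆ ε ts us

sameShape⇒Equiv ε (lnode a ts) (lnode b us) eq =
  relabel a b (sameShapes⇒StepChildren⋆ (not ε) ts us (node-injective eq))

sameShapes⇒StepChildren⋆ ε []       []       _  = ⋆-refl
sameShapes⇒StepChildren⋆ ε []       (_ ∷ _)  ()
sameShapes⇒StepChildren⋆ ε (_ ∷ _)  []       ()
sameShapes⇒StepChildren⋆ ε (t ∷ ts) (u ∷ us) eq with ∷-injective eq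
... | head-eq , tail-eq =
  here⋆ ts (sameShape⇒Equiv ε t u head-eq)
    ◅◅ there⋆ u (sameShapes⇒StepChildren⋆ ε ts us tail-eq)

proposition4p2 : (ε : Bool) (τ′ τ″ : LTree) → shape τ′ ≡ shape τ″ → Equiv ε τ′ τ″
proposition4p2 = sameShape⇒Equiv
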